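{- Let $(M,\leq_M)$ and $(N,\leq_N)$ be finite ordered monoids such that $N$ divides $M$. Then $N^1(N)\leq N^1(M)$.
   Context: An ordered monoid is a monoid with a stable partial order ($x\leq y$ implies $zx\leq zy$ and $xz\leq yz$); an order ideal is a downward closed subset. $(N,\leq_N)$ divides $(M,\leq_M)$ if there is an order-preserving surjective monoid morphism from a submonoid of $M$ (with the restricted order) onto $N$. For a finite ordered monoid $M$ and order ideal $I$, the evaluation problem $(M,I)$ of length $n$: Alice receives $m_1,m_3,\dots,m_{2n-1}\in M$, Bob receives $m_2,\dots,m_{2n}\in M$, output $1$ iff $m_1\cdots m_{2n}\in I$. $N^1(M)$ is the maximum over order ideals $I$ of the non-deterministic communication complexity of $(M,I)$, as a function of $n$ (minimum over protocols with a common proof string $s$, accepting $1$-inputs for some $s$ and $0$-inputs for no $s$, of the maximum over $1$-inputs of the minimum over accepting $s$ of $|s|$ plus bits communicated). -}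

module Defs where

open import Data.Nat using (ℕ; zero; suc; _+_; _≤_)
open import Data.Bool using (Bool; true; false)
open import Data.List using (List; length)
open import Data.List.Membership.Propositional using (_∈_)
open import Data.Vec using (Vec; []; _∷_)
open import Data.Product using (Σ; ∃; ∃-syntax; _×_; _,_; proj₁)
open import Relation.Binary.PropositionalEquality using (_≡_)
open import Relation.Binary.Structures using (IsPartialOrder)
open import Algebra.Structures using (IsMonoid)
open import Function.Bundles using (_⇔_)

record FiniteOrderedMonoid : Set₁ where
  infixl 7 _∙_
  infix 4 _≤ₘ_
  field
    Carrier        : Set
    _∙_            : Carrier → Carrier → Carrier
    ε              : Carrier
    _≤ₘ_           : Carrier → Carrier → Set
    isMonoid       : IsMonoid _≡_ _∙_ ε
    isPartialOrder : IsPartialOrder _≡_ _≤ₘ_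
    compatˡ        : ∀ {x y} z → x ≤ₘ y → z ∙ x ≤ₘ z ∙ y
    compatʳ        : ∀ {x y} z → x ≤ₘ y → x ∙ z ≤ₘ y ∙ z
    elements       : List Carrier
    complete       : ∀ x → x ∈ elements

open FiniteOrderedMonoid public

IsOrderIdeal : (M : FiniteOrderedMonoid) → (Carrier M → Set) → Set
IsOrderIdeal M I = ∀ {x y} → _≤ₘ_ M x y → I y → I x

record Divides (N M : FiniteOrderedMonoid) : Set₁ where
  field
    inSub   : Carrier M → Set
    ε-in    : inSub (ε M)
    ∙-in    : ∀ {x y} → inSub x → inSub y → inSub (_∙_ M x y)
    φ       : Σ (Carrier M) inSub → Carrier N
    φ-ε     : φ (ε M , ε-in) ≡ ε N
    φ-∙     : ∀ {x y} (px : inSub x) (py : inSub y) →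
              φ (_∙_ M x y , ∙-in px py) ≡ _∙_ N (φ (x , px)) (φ (y , py))
    φ-mono  : ∀ {x y} (px : inSub x) (py : inSub y) →
              _≤ₘ_ M x y → _≤ₘ_ N (φ (x , px)) (φ (y , py))
    φ-surj  : ∀ (z : Carrier N) → ∃[ x ] Σ (inSub x) λ px → φ (x , px) ≡ z

data Protocol (A B : Set) : Set where
  output : Bool → Protocol A B
  alice  : (A → Bool) → Protocol A B → Protocol A B → Protocol A B
  bob    : (B → Bool) → Protocol A B → Protocol A B → Protocol A B

module _ {A B : Set} where

  run : Protocol A B → A → B → Bool
  run (output b)    x y = b
  run (alice f p q) x y with f x
  ... | true  = run p x y
  ... | false = run q x y
  run (bob g p q)   x y with g y
  ... | true  = run p x y
  ... | false = run q x y

  bits : Protocol A B → A → B → ℕ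
  bits (output b)    x y = 0
  bits (alice f p q) x y with f x
  ... | true  = suc (bits p x y)
  ... | false = suc (bits q x y)
  bits (bob g p q)   x y with g y
  ... | true  = suc (bits p x y)
  ... | false = suc (bits q x y)

-- A non-deterministic protocol: for each proof string s (seen by both
-- players), a deterministic protocol.
NDProtocol : Set → Set → Set
NDProtocol A B = List Bool → Protocol A B

NDComputes : {A B : Set} → NDProtocol A B → (A → B → Set) → Set
NDComputes {A} {B} P F = ∀ (x : A) (y : B) → F x y ⇔ (∃[ s ] run (P s) x y ≡ true)

NDCostAtMost : {A B : Set} → NDProtocol A B → (A → B → Set) → ℕ → Set
NDCostAtMost {A} {B} P F k =
  ∀ (x : A) (y : B) → F x y →
    ∃[ s ] (run (P s) x y ≡ true × length s + bits (P s) x y ≤ k)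

NCC≤ : {A B : Set} → (A → B → Set) → ℕ → Set
NCC≤ F k = ∃[ P ] (NDComputes P F × NDCostAtMost P F k)

-- Evaluation problem (M, I) of length n.
-- Alice holds a = (m₁, m₃, …, m₂ₙ₋₁), Bob holds b = (m₂, m₄, …, m₂ₙ);
-- evalProd a b = m₁ m₂ m₃ ⋯ m₂ₙ.

evalProd : (M : FiniteOrderedMonoid) {n : ℕ} →
           Vec (Carrier M) n → Vec (Carrier M) n → Carrier M
evalProd M []       []       = ε M
evalProd M (a ∷ as) (b ∷ bs) = _∙_ M (_∙_ M a b) (evalProd M as bs)

EvalProblem : (M : FiniteOrderedMonoid) (I : Carrier M → Set) (n : ℕ) →
              Vec (Carrier M) n → Vec (Carrier M) n → Set
EvalProblem M I n a b = I (evalProd M a b)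

N¹≤ : FiniteOrderedMonoid → ℕ → ℕ → Set₁
N¹≤ M n k = ∀ (I : Carrier M → Set) → IsOrderIdeal M I → NCC≤ (EvalProblem M I n) k

-- A protocol for (M, J) also solves (N, I) once each player replaces every
-- letter z of N by a fixed preimage under the division morphism φ, provided
-- J is chosen so that J x ⇔ I (φ x) on the submonoid.  The right J is the
-- downward closure in M of φ⁻¹(I): it is an order ideal of M, and on the
-- submonoid it agrees with φ⁻¹(I) because φ is monotone and I is downward
-- closed.  Reindexing the inputs changes neither proof strings nor bits.
module Submission where

open import Defs
open import Data.Nat using (ℕ; suc; _+_; _≤_)
open import Data.Bool using (true; false)
open import Data.List using (length)
open import Data.Vec using (Vec; []; _∷_; map)
open import Data.Product using (Σ; ∃-syntax; _×_; _,_; proj₁; proj₂)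
open import Relation.Binary.PropositionalEquality
  using (_≡_; refl; sym; trans; cong; cong₂; subst; module ≡-Reasoning)
open import Relation.Binary.Structures using (IsPartialOrder)
open import Function.Bundles using (_⇔_; mk⇔; Equivalence)
import Function.Properties.Equivalence as ⇔

reindex : {A B A′ B′ : Set} → (A′ → A) → (B′ → B) → Protocol A B → Protocol A′ B′
reindex f g (output b)    = output b
reindex f g (alice h p q) = alice (λ x → h (f x)) (reindex f g p) (reindex f g q)
reindex f g (bob h p q)   = bob (λ y → h (g y)) (reindex f g p) (reindex f g q)

module _ {A B A′ B′ : Set} (f : A′ → A) (g : B′ → B) where

  run-reindex : ∀ p x y → run (reindex f g p) x y ≡ run p (f x) (g y)
  run-reindex (output b)    x y = refl
  run-reindex (alice h p q) x y with h (f x)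
  ... | true  = run-reindex p x y
  ... | false = run-reindex q x y
  run-reindex (bob h p q)   x y with h (g y)
  ... | true  = run-reindex p x y
  ... | false = run-reindex q x y

  bits-reindex : ∀ p x y → bits (reindex f g p) x y ≡ bits p (f x) (g y)
  bits-reindex (output b)    x y = refl
  bits-reindex (alice h p q) x y with h (f x)
  ... | true  = cong suc (bits-reindex p x y)
  ... | false = cong suc (bits-reindex q x y)
  bits-reindex (bob h p q)   x y with h (g y)
  ... | true  = cong suc (bits-reindex p x y)
  ... | false = cong suc (bits-reindex q x y)

  NCC≤-reduce : {F : A → B → Set} {F′ : A′ → B′ → Set} →
                (∀ x y → F′ x y ⇔ F (f x) (g y)) →
                ∀ k → NCC≤ F k → NCC≤ F′ k
  NCC≤-reduce {F} {F′} F′⇔F k (P , computes , cost) = P′ , computes′ , cost′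
    where
    P′ : NDProtocol A′ B′
    P′ s = reindex f g (P s)

    accepts⇔ : ∀ x y → (∃[ s ] run (P s) (f x) (g y) ≡ true) ⇔ (∃[ s ] run (P′ s) x y ≡ true)
    accepts⇔ x y = mk⇔
      (λ (s , r) → s , trans (run-reindex (P s) x y) r)
      (λ (s , r) → s , trans (sym (run-reindex (P s) x y)) r)

    computes′ : NDComputes P′ F′
    computes′ x y = ⇔.trans (F′⇔F x y) (⇔.trans (computes (f x) (g y)) (accepts⇔ x y))

    cost′ : NDCostAtMost P′ F′ k
    cost′ x y F′xy with cost (f x) (g y) (Equivalence.to (F′⇔F x y) F′xy)
    ... | s , r , c = s , trans (run-reindex (P s) x y) r ,
                      subst (λ t → length s + t ≤ k) (sym (bits-reindex (P s) x y)) c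

module _ {M N : FiniteOrderedMonoid} (D : Divides N M) where
  open Divides D
  open IsPartialOrder (isPartialOrder M) using () renaming (refl to ≤-refl; trans to ≤-trans)

  lift : Carrier N → Carrier M
  lift z = proj₁ (φ-surj z)

  lift-in : ∀ z → inSub (lift z)
  lift-in z = proj₁ (proj₂ (φ-surj z))

  φ-lift : ∀ z → φ (lift z , lift-in z) ≡ z
  φ-lift z = proj₂ (proj₂ (φ-surj z))

  evalProd-lift-in : ∀ {n} (a b : Vec (Carrier N) n) → inSub (evalProd M (map lift a) (map lift b))
  evalProd-lift-in []       []       = ε-in
  evalProd-lift-in (a ∷ as) (b ∷ bs) = ∙-in (∙-in (lift-in a) (lift-in b)) (evalProd-lift-in as bs)

  φ-evalProd-lift : ∀ {n} (a b : Vec (Carrier N) n) →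
                    φ (evalProd M (map lift a) (map lift b) , evalProd-lift-in a b) ≡ evalProd N a b
  φ-evalProd-lift []       []       = φ-ε
  φ-evalProd-lift (a ∷ as) (b ∷ bs) = begin
    φ (_∙_ M (_∙_ M (lift a) (lift b)) rest , _)
      ≡⟨ φ-∙ (∙-in (lift-in a) (lift-in b)) (evalProd-lift-in as bs) ⟩
    _∙_ N (φ (_∙_ M (lift a) (lift b) , _)) (φ (rest , _))
      ≡⟨ cong₂ (_∙_ N) (φ-∙ (lift-in a) (lift-in b)) (φ-evalProd-lift as bs) ⟩
    _∙_ N (_∙_ N (φ (lift a , _)) (φ (lift b , _))) (evalProd N as bs)
      ≡⟨ cong₂ (λ x y → _∙_ N (_∙_ N x y) (evalProd N as bs)) (φ-lift a) (φ-lift b) ⟩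
    evalProd N (a ∷ as) (b ∷ bs) ∎
    where
    open ≡-Reasoning
    rest = evalProd M (map lift as) (map lift bs)

  pullback : (Carrier N → Set) → Carrier M → Set
  pullback I x = ∃[ z ] Σ (inSub z) λ pz → _≤ₘ_ M x z × I (φ (z , pz))

  pullback-isOrderIdeal : ∀ I → IsOrderIdeal M (pullback I)
  pullback-isOrderIdeal I x≤y (z , pz , y≤z , Iz) = z , pz , ≤-trans x≤y y≤z , Iz

  pullback-inSub : ∀ {I} → IsOrderIdeal N I → ∀ {x} (px : inSub x) → pullback I x ⇔ I (φ (x , px))
  pullback-inSub isIdeal {x} px = mk⇔
    (λ (z , pz , x≤z , Iz) → isIdeal (φ-mono px pz x≤z) Iz)
    (λ Ix → x , px , ≤-refl , Ix)

  evalProblem-pullback : ∀ {I} → IsOrderIdeal N I → ∀ n (a b : Vec (Carrier N) n) →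
                         EvalProblem N I n a b ⇔ EvalProblem M (pullback I) n (map lift a) (map lift b)
  evalProblem-pullback {I} isIdeal n a b = ⇔.sym (subst
    (λ z → EvalProblem M (pullback I) n (map lift a) (map lift b) ⇔ I z)
    (φ-evalProd-lift a b)
    (pullback-inSub isIdeal (evalProd-lift-in a b)))

lemma4p4 : (M N : FiniteOrderedMonoid) → Divides N M →
    ∀ (n k : ℕ) → N¹≤ M n k → N¹≤ N n k
lemma4p4 M N D n k N¹M≤k I isIdeal =
  NCC≤-reduce (map (lift D)) (map (lift D)) (evalProblem-pullback D isIdeal n) k
    (N¹M≤k (pullback D I) (pullback-isOrderIdeal D I))
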